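{- For any positive integers $r,t\ge 3$, $(K_r\times K_t)_{SR}\cong K_r\Box K_t$.
   Context: $K_n$ is the complete graph of order $n$. The direct product $G\times H$ has vertex set $V(G)\times V(H)$, with $(a,b)\sim(c,d)$ iff $ac\in E(G)$ and $bd\in E(H)$; the Cartesian product $G\Box H$ has vertex set $V(G)\times V(H)$, with $(a,b)\sim(c,d)$ iff ($a=c$ and $bd\in E(H)$) or ($b=d$ and $ac\in E(G)$). For a connected graph $G$ with distance $d_G$, a vertex $u$ is maximally distant from $v$ if $d_G(v,w)\le d_G(u,v)$ for every neighbor $w$ of $u$; $u,v$ are mutually maximally distant if each is maximally distant from the other. The boundary $\partial(G)$ is the set of vertices $u$ for which some $v$ exists with $u,v$ mutually maximally distant. The strong resolving graph $G_{SR}$ has vertex set $\partial(G)$, two vertices adjacent iff they are mutually maximally distant in $G$. -}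

module Defs where

open import Data.Nat using (ℕ; zero; suc; _≤_; _<_)
open import Data.Fin using (Fin)
open import Data.Product using (Σ; ∃; _×_; _,_)
open import Data.Sum using (_⊎_)
open import Relation.Nullary using (¬_)
open import Relation.Binary.PropositionalEquality using (_≡_)
open import Function.Bundles using (_⇔_)
open import Function.Definitions using (Injective)

record Graph : Set₁ where
  field
    V   : Set
    Adj : V → V → Set
open Graph public

K : ℕ → Graph
K n = record { V = Fin n ; Adj = λ i j → ¬ (i ≡ j) }

_×ᵍ_ : Graph → Graph → Graph
G ×ᵍ H = record
  { V   = V G × V H
  ; Adj = λ { (a , b) (c , d) → Adj G a c × Adj H b d } }

_□_ : Graph → Graph → Graph
G □ H = record
  { V   = V G × V H
  ; Adj = λ { (a , b) (c , d) → (a ≡ c × Adj H b d) ⊎ (b ≡ d × Adj G a c) } }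

data Walk (G : Graph) : V G → V G → ℕ → Set where
  here : ∀ {u} → Walk G u u zero
  step : ∀ {u w v k} → Adj G u w → Walk G w v k → Walk G u v (suc k)

Dist : (G : Graph) → V G → V G → ℕ → Set
Dist G u v k = Walk G u v k × (∀ m → m < k → ¬ Walk G u v m)

MaxDistFrom : (G : Graph) → V G → V G → Set
MaxDistFrom G u v =
  ∀ w → Adj G u w → ∀ a b → Dist G v w a → Dist G u v b → a ≤ b

MMD : (G : Graph) → V G → V G → Set
MMD G u v = MaxDistFrom G u v × MaxDistFrom G v u

Boundary : (G : Graph) → V G → Set
Boundary G u = ∃ λ v → MMD G u v

-- H ≅ G_SR : a bijection f from V(H) onto ∂(G) such that
-- x ~_H y iff f x, f y are mutually maximally distant in G
-- (i.e. adjacent in the strong resolving graph G_SR).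
record IsoToSR (G H : Graph) : Set where
  field
    f      : V H → V G
    inj    : Injective _≡_ _≡_ f
    into   : ∀ x → Boundary G (f x)
    onto   : ∀ u → Boundary G u → ∃ λ x → f x ≡ u
    adj    : ∀ x y → Adj H x y ⇔ MMD G (f x) (f y)

_SR≅_ : Graph → Graph → Set
G SR≅ H = IsoToSR G H

-- For r, t ≥ 3 any two vertices of K_r × K_t are joined by a walk of length 2, so the graph has
-- diameter at most 2 and the vertices at distance 2 are exactly the pairs agreeing in one
-- coordinate, i.e. the edges of K_r □ K_t. In a graph of diameter 2, vertices at distance 2 are
-- mutually maximally distant. Conversely a vertex u is not maximally distant from a vertex v at
-- distance at most 1: some neighbour of u lies at distance 2 from v (or 1 from v = u).
-- Every vertex has a □-neighbour, so ∂(K_r × K_t) is everything and the identity is the isomorphism.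
module Submission where

open import Defs
open import Data.Nat using (ℕ; zero; suc; _≤_; _<_; z≤n; s≤s)
open import Data.Nat.Properties using (≤-trans; ≮⇒≥; <⇒≱)
open import Data.Fin using (Fin; zero; suc)
open import Data.Fin.Properties using (_≟_)
open import Data.Product using (∃-syntax; _×_; _,_; proj₁)
open import Data.Sum using (inj₁; inj₂)
open import Data.Empty using (⊥-elim)
open import Relation.Nullary using (¬_; yes; no)
open import Relation.Binary.PropositionalEquality using (_≢_; refl; ≢-sym)
open import Function.Bundles using (mk⇔)

avoid₂ : ∀ {n} → 3 ≤ n → (i j : Fin n) → ∃[ k ] (k ≢ i × k ≢ j)
avoid₂ (s≤s (s≤s (s≤s _))) i j with zero ≟ i | zero ≟ j
... | no 0≢i   | no 0≢j   = zero , 0≢i , 0≢j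
... | yes refl | yes refl = suc zero , (λ ()) , (λ ())
... | yes refl | no _ with suc zero ≟ j
...   | no 1≢j   = suc zero , (λ ()) , 1≢j
...   | yes refl = suc (suc zero) , (λ ()) , (λ ())
avoid₂ (s≤s (s≤s (s≤s _))) i j | no _ | yes refl with suc zero ≟ i
...   | no 1≢i   = suc zero , 1≢i , (λ ())
...   | yes refl = suc (suc zero) , (λ ()) , (λ ())

module _ {G : Graph} where

  dist-≤-walk : ∀ {u v k m} → Dist G u v k → Walk G u v m → k ≤ m
  dist-≤-walk (_ , shortest) w = ≮⇒≥ (λ m<k → shortest _ m<k w)

  dist-refl : ∀ {u} → Dist G u u 0
  dist-refl = here , λ _ ()

  dist-one : ∀ {u v} → u ≢ v → Adj G u v → Dist G u v 1
  dist-one u≢v e = step e here , λ { zero _ here → u≢v refl ; (suc _) (s≤s ()) _ }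

  dist-two : ∀ {u v} → u ≢ v → ¬ Adj G u v → Walk G u v 2 → Dist G u v 2
  dist-two {u} {v} u≢v ¬adj w = w , no-shorter
    where
    no-shorter : ∀ m → m < 2 → ¬ Walk G u v m
    no-shorter zero          _              here          = u≢v refl
    no-shorter (suc zero)    _              (step e here) = ¬adj e
    no-shorter (suc (suc _)) (s≤s (s≤s ())) _

  maxDistFrom-diameter₂ : (∀ x y → Walk G x y 2) →
                          ∀ {u v} → Dist G u v 2 → MaxDistFrom G u v
  maxDistFrom-diameter₂ walk₂ {v = v} duv w _ a b dvw duv′ =
    ≤-trans (dist-≤-walk dvw (walk₂ v w)) (dist-≤-walk duv (proj₁ duv′))

  farther-neighbour⇒¬maxDistFrom : ∀ {u v w a b} → Adj G u w → Dist G v w a →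
                                   Dist G u v b → b < a → ¬ MaxDistFrom G u v
  farther-neighbour⇒¬maxDistFrom {w = w} {a} {b} adj dvw duv b<a maxDist =
    <⇒≱ b<a (maxDist w adj a b dvw duv)

module _ {r t : ℕ} (hr : 3 ≤ r) (ht : 3 ≤ t) where

  private
    G = K r ×ᵍ K t
    H = K r □ K t

  ×-walk₂ : ∀ x y → Walk G x y 2
  ×-walk₂ (a , b) (c , d) with avoid₂ hr a c | avoid₂ ht b d
  ... | e , e≢a , e≢c | f , f≢b , f≢d =
    step (≢-sym e≢a , ≢-sym f≢b) (step (e≢c , f≢d) here)

  ×-adj⇒≢ : ∀ {x y} → Adj G x y → x ≢ y
  ×-adj⇒≢ (a≢c , _) refl = a≢c refl

  □-adj⇒≢ : ∀ {x y} → Adj H x y → x ≢ y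
  □-adj⇒≢ (inj₁ (_ , b≢d)) refl = b≢d refl
  □-adj⇒≢ (inj₂ (_ , a≢c)) refl = a≢c refl

  □-adj⇒¬×-adj : ∀ {x y} → Adj H x y → ¬ Adj G x y
  □-adj⇒¬×-adj (inj₁ (refl , _)) (a≢a , _) = a≢a refl
  □-adj⇒¬×-adj (inj₂ (refl , _)) (_ , b≢b) = b≢b refl

  □-sym : ∀ {x y} → Adj H x y → Adj H y x
  □-sym (inj₁ (refl , b≢d)) = inj₁ (refl , ≢-sym b≢d)
  □-sym (inj₂ (refl , a≢c)) = inj₂ (refl , ≢-sym a≢c)

  □-adj⇒dist₂ : ∀ {x y} → Adj H x y → Dist G x y 2
  □-adj⇒dist₂ xy = dist-two (□-adj⇒≢ xy) (□-adj⇒¬×-adj xy) (×-walk₂ _ _)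

  □-adj⇒mmd : ∀ {x y} → Adj H x y → MMD G x y
  □-adj⇒mmd xy = maxDistFrom-diameter₂ ×-walk₂ (□-adj⇒dist₂ xy)
               , maxDistFrom-diameter₂ ×-walk₂ (□-adj⇒dist₂ (□-sym xy))

  mmd⇒□-adj : ∀ x y → MMD G x y → Adj H x y
  mmd⇒□-adj (a , b) (c , d) (maxDist , _) with a ≟ c | b ≟ d
  ... | yes refl | no b≢d  = inj₁ (refl , b≢d)
  ... | no a≢c   | yes refl = inj₂ (refl , a≢c)
  ... | yes refl | yes refl with avoid₂ hr a a | avoid₂ ht b b
  ...   | e , e≢a , _ | f , f≢b , _ =
    ⊥-elim (farther-neighbour⇒¬maxDistFrom adj (dist-one (×-adj⇒≢ adj) adj) dist-refl
                                           (s≤s z≤n) maxDist)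
    where
    adj : Adj G (a , b) (e , f)
    adj = ≢-sym e≢a , ≢-sym f≢b
  mmd⇒□-adj (a , b) (c , d) (maxDist , _) | no a≢c | no b≢d with avoid₂ ht b d
  ... | f , f≢b , f≢d =
    ⊥-elim (farther-neighbour⇒¬maxDistFrom {w = c , f} (a≢c , ≢-sym f≢b)
              (□-adj⇒dist₂ (inj₁ (refl , ≢-sym f≢d)))
              (dist-one (×-adj⇒≢ (a≢c , b≢d)) (a≢c , b≢d))
              (s≤s (s≤s z≤n)) maxDist)

  ×-boundary : ∀ x → Boundary G x
  ×-boundary (a , b) with avoid₂ ht b b
  ... | g , g≢b , _ = (a , g) , □-adj⇒mmd (inj₁ (refl , ≢-sym g≢b))

lemma32 : ∀ (r t : ℕ) → 3 ≤ r → 3 ≤ t → (K r ×ᵍ K t) SR≅ (K r □ K t)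
lemma32 r t hr ht = record
  { f    = λ x → x
  ; inj  = λ x≡y → x≡y
  ; into = ×-boundary hr ht
  ; onto = λ u _ → u , refl
  ; adj  = λ x y → mk⇔ (□-adj⇒mmd hr ht) (mmd⇒□-adj hr ht x y)
  }
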